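{- For every $\Gamma\cup\{\phi\}\subseteq\mathcal{L}_{\triangledown}$: $\Gamma\vdash_{\mathsf{iM}}\phi \iff \Gamma^{\Box}\vdash_{\mathsf{WM}}\phi^{\Box}\iff\Gamma^{\Box}\vdash_{\mathsf{IM}}\phi^{\Box}$.
   Context: $\mathcal{L}_{\triangledown}$: formulas $\phi ::= p_i \mid \bot \mid \phi\wedge\phi \mid \phi\vee\phi \mid \phi\to\phi \mid \triangledown\phi$; $\mathcal{L}_{\Box\Diamond}$: formulas $\phi ::= p_i \mid \bot \mid \phi\wedge\phi \mid \phi\vee\phi \mid \phi\to\phi \mid \Box\phi\mid\Diamond\phi$, over the same countable set of proposition letters; $\neg\phi:=\phi\to\bot$, $\top:=\neg\bot$. For $\phi\in\mathcal{L}_{\triangledown}$, $\phi^{\Box}\in\mathcal{L}_{\Box\Diamond}$ replaces every $\triangledown$ by $\Box$; $\Gamma^{\Box}=\{\psi^{\Box}\mid\psi\in\Gamma\}$. Generalised Hilbert calculi: given a set $\mathscr{Ax}$ of formulas (always including all substitution instances of a standard axiomatisation of intuitionistic propositional logic), derivable consecutions $\Gamma\vdash\phi$ are generated by (El) $\Gamma\vdash\phi$ for $\phi\in\Gamma$; (Ax) $\Gamma\vdash\psi$ for $\psi\in\mathscr{Ax}$; (MP) from $\Gamma\vdash\phi$ and $\Gamma\vdash\phi\to\psi$ infer $\Gamma\vdash\psi$; and for each modality $\heartsuit$ of the language, (Mon$_\heartsuit$) from $\emptyset\vdash\phi\to\psi$ infer $\Gamma\vdash\heartsuit\phi\to\heartsuit\psi$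 (any $\Gamma$). $\mathsf{iM}$: language $\mathcal{L}_{\triangledown}$, no extra axioms. $\mathsf{WM}$: language $\mathcal{L}_{\Box\Diamond}$, extra axioms all substitution instances of $(\Box p\wedge\Diamond\neg p)\to\bot$. $\mathsf{IM}$: language $\mathcal{L}_{\Box\Diamond}$, extra axioms all substitution instances of $(\Box p\wedge\Diamond\neg p)\to\bot$ and $(\Box\top\to\Diamond p)\to\Diamond p$. -}

module Defs where

open import Data.Nat using (ℕ)
open import Data.Product using (Σ; _×_; _,_)
open import Relation.Binary.PropositionalEquality using (_≡_)
open import Data.Empty using (⊥)

data Fm▽ : Set where
  var  : ℕ → Fm▽
  ⊥'   : Fm▽
  _∧'_ : Fm▽ → Fm▽ → Fm▽
  _∨'_ : Fm▽ → Fm▽ → Fm▽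
  _⇒_  : Fm▽ → Fm▽ → Fm▽
  ▽    : Fm▽ → Fm▽

data Fm□◇ : Set where
  var  : ℕ → Fm□◇
  ⊥'   : Fm□◇
  _∧'_ : Fm□◇ → Fm□◇ → Fm□◇
  _∨'_ : Fm□◇ → Fm□◇ → Fm□◇
  _⇒_  : Fm□◇ → Fm□◇ → Fm□◇
  □    : Fm□◇ → Fm□◇
  ◇    : Fm□◇ → Fm□◇

infixr 6 _∧'_
infixr 5 _∨'_
infixr 4 _⇒_

Set▽ : Set₁
Set▽ = Fm▽ → Set

Set□◇ : Set₁
Set□◇ = Fm□◇ → Set

-- Translation φ ↦ φ^□ and Γ^□ = { ψ^□ | ψ ∈ Γ }

_ᵇ : Fm▽ → Fm□◇
var i ᵇ    = var i
⊥' ᵇ       = ⊥'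
(φ ∧' ψ) ᵇ = (φ ᵇ) ∧' (ψ ᵇ)
(φ ∨' ψ) ᵇ = (φ ᵇ) ∨' (ψ ᵇ)
(φ ⇒ ψ) ᵇ  = (φ ᵇ) ⇒ (ψ ᵇ)
▽ φ ᵇ      = □ (φ ᵇ)

_ˢᵇ : Set▽ → Set□◇
(Γ ˢᵇ) χ = Σ Fm▽ (λ ψ → Γ ψ × (ψ ᵇ) ≡ χ)

-- A standard Hilbert axiomatisation of intuitionistic propositional logic,
-- given schematically (hence closed under substitution) over any language
-- with the propositional connectives.

module IPC {F : Set} (⊥F : F) (_∧F_ _∨F_ _⇒F_ : F → F → F) where
  data IPCAx : F → Set where
    ax-K    : ∀ a b   → IPCAx (a ⇒F (b ⇒F a))
    ax-S    : ∀ a b c → IPCAx ((a ⇒F (b ⇒F c)) ⇒F ((a ⇒F b) ⇒F (a ⇒F c)))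
    ax-∧E₁  : ∀ a b   → IPCAx ((a ∧F b) ⇒F a)
    ax-∧E₂  : ∀ a b   → IPCAx ((a ∧F b) ⇒F b)
    ax-∧I   : ∀ a b   → IPCAx (a ⇒F (b ⇒F (a ∧F b)))
    ax-∨I₁  : ∀ a b   → IPCAx (a ⇒F (a ∨F b))
    ax-∨I₂  : ∀ a b   → IPCAx (b ⇒F (a ∨F b))
    ax-∨E   : ∀ a b c → IPCAx ((a ⇒F c) ⇒F ((b ⇒F c) ⇒F ((a ∨F b) ⇒F c)))
    ax-⊥E   : ∀ a     → IPCAx (⊥F ⇒F a)

IPC▽ : Fm▽ → Set
IPC▽ = IPC.IPCAx ⊥' _∧'_ _∨'_ _⇒_

IPC□◇ : Fm□◇ → Set
IPC□◇ = IPC.IPCAx ⊥' _∧'_ _∨'_ _⇒_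

¬' : Fm□◇ → Fm□◇
¬' φ = φ ⇒ ⊥'

⊤' : Fm□◇
⊤' = ¬' ⊥'

∅▽ : Set▽
∅▽ _ = ⊥

∅□◇ : Set□◇
∅□◇ _ = ⊥

data Der▽ (Ax : Fm▽ → Set) (Γ : Set▽) : Fm▽ → Set where
  el   : ∀ {φ} → Γ φ → Der▽ Ax Γ φ
  ax   : ∀ {φ} → Ax φ → Der▽ Ax Γ φ
  mp   : ∀ {φ ψ} → Der▽ Ax Γ φ → Der▽ Ax Γ (φ ⇒ ψ) → Der▽ Ax Γ ψ
  mon▽ : ∀ {φ ψ} → Der▽ Ax ∅▽ (φ ⇒ ψ) → Der▽ Ax Γ (▽ φ ⇒ ▽ ψ)

data Der□◇ (Ax : Fm□◇ → Set) (Γ : Set□◇) : Fm□◇ → Set where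
  el   : ∀ {φ} → Γ φ → Der□◇ Ax Γ φ
  ax   : ∀ {φ} → Ax φ → Der□◇ Ax Γ φ
  mp   : ∀ {φ ψ} → Der□◇ Ax Γ φ → Der□◇ Ax Γ (φ ⇒ ψ) → Der□◇ Ax Γ ψ
  mon□ : ∀ {φ ψ} → Der□◇ Ax ∅□◇ (φ ⇒ ψ) → Der□◇ Ax Γ (□ φ ⇒ □ ψ)
  mon◇ : ∀ {φ ψ} → Der□◇ Ax ∅□◇ (φ ⇒ ψ) → Der□◇ Ax Γ (◇ φ ⇒ ◇ ψ)

_⊢iM_ : Set▽ → Fm▽ → Set
Γ ⊢iM φ = Der▽ IPC▽ Γ φ

data WMAx : Fm□◇ → Set where
  ipc : ∀ {φ} → IPC□◇ φ → WMAx φ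
  wm  : ∀ a → WMAx ((□ a ∧' ◇ (¬' a)) ⇒ ⊥')

data IMAx : Fm□◇ → Set where
  ipc : ∀ {φ} → IPC□◇ φ → IMAx φ
  wm  : ∀ a → IMAx ((□ a ∧' ◇ (¬' a)) ⇒ ⊥')
  im  : ∀ a → IMAx ((□ ⊤' ⇒ ◇ a) ⇒ ◇ a)

_⊢WM_ : Set□◇ → Fm□◇ → Set
Γ ⊢WM φ = Der□◇ WMAx Γ φ

_⊢IM_ : Set□◇ → Fm□◇ → Set
Γ ⊢IM φ = Der□◇ IMAx Γ φ

infix 2 _⊢iM_ _⊢WM_ _⊢IM_

{-# OPTIONS --safe #-}
module Submission where

open import Defs
open import Data.Product using (_×_; _,_)
open import Data.Sum using (_⊎_; inj₁; inj₂)
open import Function.Base using (_∘_)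
open import Function.Bundles using (_⇔_; mk⇔)
open import Relation.Binary.PropositionalEquality using (_≡_; refl; sym; cong; cong₂; subst)
open IPC

-- The inclusions iM ⊆ WM ⊆ IM along ᵇ are immediate: IPC axioms go to IPC
-- axioms and (Mon▽) to (Mon□). For the converse, translate back to L▽ reading
-- every ◇ψ as ¬▽⊤. This is a left inverse of ᵇ, (Mon◇) becomes trivial, the WM
-- axiom becomes ▽a ∧ ¬▽⊤ → ⊥, which holds since ▽a → ▽⊤ by (Mon▽), and the IM
-- axiom becomes (▽⊤ → ¬▽⊤) → ¬▽⊤, an instance of contraction. So every
-- IM-derivation of Γ^□ ⊢ φ^□ translates back to an iM-derivation of Γ ⊢ φ.

_⸴_ : Set▽ → Fm▽ → Set▽
(Γ ⸴ A) χ = Γ χ ⊎ χ ≡ A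

module Deduction {Ax : Fm▽ → Set} (fromIPC : ∀ {φ} → IPC▽ φ → Ax φ) where

  ⇒-refl : ∀ {Γ} A → Der▽ Ax Γ (A ⇒ A)
  ⇒-refl A = mp (ax (fromIPC (ax-K A A)))
                (mp (ax (fromIPC (ax-K A (A ⇒ A)))) (ax (fromIPC (ax-S A (A ⇒ A) A))))

  ⇒-const : ∀ {Γ A B} → Der▽ Ax Γ B → Der▽ Ax Γ (A ⇒ B)
  ⇒-const d = mp d (ax (fromIPC (ax-K _ _)))

  hyp : ∀ {Γ A} → Der▽ Ax (Γ ⸴ A) A
  hyp = el (inj₂ refl)

  deduction : ∀ {Γ A B} → Der▽ Ax (Γ ⸴ A) B → Der▽ Ax Γ (A ⇒ B)
  deduction (el (inj₁ x))    = ⇒-const (el x)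
  deduction (el (inj₂ refl)) = ⇒-refl _
  deduction (ax x)           = ⇒-const (ax x)
  deduction (mp d e)         = mp (deduction d) (mp (deduction e) (ax (fromIPC (ax-S _ _ _))))
  deduction (mon▽ d)         = ⇒-const (mon▽ d)

open Deduction {IPC▽} (λ x → x)

mapAx-Der□◇ : ∀ {Ax Ax′ Γ φ} → (∀ {ψ} → Ax ψ → Ax′ ψ) → Der□◇ Ax Γ φ → Der□◇ Ax′ Γ φ
mapAx-Der□◇ f (el x)   = el x
mapAx-Der□◇ f (ax x)   = ax (f x)
mapAx-Der□◇ f (mp d e) = mp (mapAx-Der□◇ f d) (mapAx-Der□◇ f e)
mapAx-Der□◇ f (mon□ d) = mon□ (mapAx-Der□◇ f d)
mapAx-Der□◇ f (mon◇ d) = mon◇ (mapAx-Der□◇ f d)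

WMAx⊆IMAx : ∀ {φ} → WMAx φ → IMAx φ
WMAx⊆IMAx (ipc x) = ipc x
WMAx⊆IMAx (wm a)  = wm a

ᵇ-IPC : ∀ {φ} → IPC▽ φ → IPC□◇ (φ ᵇ)
ᵇ-IPC (ax-K a b)    = ax-K _ _
ᵇ-IPC (ax-S a b c)  = ax-S _ _ _
ᵇ-IPC (ax-∧E₁ a b)  = ax-∧E₁ _ _
ᵇ-IPC (ax-∧E₂ a b)  = ax-∧E₂ _ _
ᵇ-IPC (ax-∧I a b)   = ax-∧I _ _
ᵇ-IPC (ax-∨I₁ a b)  = ax-∨I₁ _ _
ᵇ-IPC (ax-∨I₂ a b)  = ax-∨I₂ _ _
ᵇ-IPC (ax-∨E a b c) = ax-∨E _ _ _
ᵇ-IPC (ax-⊥E a)     = ax-⊥E _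

ᵇ-Der : ∀ {Ax Γ Δ φ} → (∀ {ψ} → IPC□◇ ψ → Ax ψ) → (∀ {ψ} → Γ ψ → Δ (ψ ᵇ)) →
        Γ ⊢iM φ → Der□◇ Ax Δ (φ ᵇ)
ᵇ-Der fromIPC h (el x)   = el (h x)
ᵇ-Der fromIPC h (ax x)   = ax (fromIPC (ᵇ-IPC x))
ᵇ-Der fromIPC h (mp d e) = mp (ᵇ-Der fromIPC h d) (ᵇ-Der fromIPC h e)
ᵇ-Der fromIPC h (mon▽ d) = mon□ (ᵇ-Der fromIPC (λ ()) d)

⊤▽ : Fm▽
⊤▽ = ⊥' ⇒ ⊥'

¬▽⊤ : Fm▽
¬▽⊤ = ▽ ⊤▽ ⇒ ⊥'

unᵇ : Fm□◇ → Fm▽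
unᵇ (var i)  = var i
unᵇ ⊥'       = ⊥'
unᵇ (a ∧' b) = unᵇ a ∧' unᵇ b
unᵇ (a ∨' b) = unᵇ a ∨' unᵇ b
unᵇ (a ⇒ b)  = unᵇ a ⇒ unᵇ b
unᵇ (□ a)    = ▽ (unᵇ a)
unᵇ (◇ a)    = ¬▽⊤

unᵇ-ᵇ : ∀ φ → unᵇ (φ ᵇ) ≡ φ
unᵇ-ᵇ (var i)  = refl
unᵇ-ᵇ ⊥'       = refl
unᵇ-ᵇ (φ ∧' ψ) = cong₂ _∧'_ (unᵇ-ᵇ φ) (unᵇ-ᵇ ψ)
unᵇ-ᵇ (φ ∨' ψ) = cong₂ _∨'_ (unᵇ-ᵇ φ) (unᵇ-ᵇ ψ)
unᵇ-ᵇ (φ ⇒ ψ)  = cong₂ _⇒_ (unᵇ-ᵇ φ) (unᵇ-ᵇ ψ)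
unᵇ-ᵇ (▽ φ)    = cong ▽ (unᵇ-ᵇ φ)

unᵇ-IPC : ∀ {φ} → IPC□◇ φ → IPC▽ (unᵇ φ)
unᵇ-IPC (ax-K a b)    = ax-K _ _
unᵇ-IPC (ax-S a b c)  = ax-S _ _ _
unᵇ-IPC (ax-∧E₁ a b)  = ax-∧E₁ _ _
unᵇ-IPC (ax-∧E₂ a b)  = ax-∧E₂ _ _
unᵇ-IPC (ax-∧I a b)   = ax-∧I _ _
unᵇ-IPC (ax-∨I₁ a b)  = ax-∨I₁ _ _
unᵇ-IPC (ax-∨I₂ a b)  = ax-∨I₂ _ _
unᵇ-IPC (ax-∨E a b c) = ax-∨E _ _ _
unᵇ-IPC (ax-⊥E a)     = ax-⊥E _

▽-⊤ : ∀ {Γ} a → Γ ⊢iM ▽ a ⇒ ▽ ⊤▽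
▽-⊤ a = mon▽ (⇒-const (⇒-refl ⊥'))

unᵇ-wm : ∀ {Γ} a → Γ ⊢iM (▽ a ∧' ¬▽⊤) ⇒ ⊥'
unᵇ-wm a = deduction (mp (mp (mp hyp (ax (ax-∧E₁ _ _))) (▽-⊤ a)) (mp hyp (ax (ax-∧E₂ _ _))))

unᵇ-im : ∀ {Γ} → Γ ⊢iM (▽ ⊤▽ ⇒ ¬▽⊤) ⇒ ¬▽⊤
unᵇ-im = deduction (mp (⇒-refl _) (mp hyp (ax (ax-S _ _ _))))

unᵇ-IMAx : ∀ {Γ φ} → IMAx φ → Γ ⊢iM unᵇ φ
unᵇ-IMAx (ipc x) = ax (unᵇ-IPC x)
unᵇ-IMAx (wm a)  = unᵇ-wm (unᵇ a)
unᵇ-IMAx (im a)  = unᵇ-im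

unᵇ-Der : ∀ {Δ Γ φ} → (∀ {ψ} → Δ ψ → Γ ⊢iM unᵇ ψ) → Δ ⊢IM φ → Γ ⊢iM unᵇ φ
unᵇ-Der h (el x)   = h x
unᵇ-Der h (ax x)   = unᵇ-IMAx x
unᵇ-Der h (mp d e) = mp (unᵇ-Der h d) (unᵇ-Der h e)
unᵇ-Der h (mon□ d) = mon▽ (unᵇ-Der (λ ()) d)
unᵇ-Der h (mon◇ d) = ⇒-refl ¬▽⊤

⊢iM⇒⊢WM : ∀ {Γ φ} → Γ ⊢iM φ → Γ ˢᵇ ⊢WM φ ᵇ
⊢iM⇒⊢WM = ᵇ-Der ipc (λ {ψ} x → ψ , x , refl)

⊢WM⇒⊢IM : ∀ {Δ φ} → Δ ⊢WM φ → Δ ⊢IM φ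
⊢WM⇒⊢IM = mapAx-Der□◇ WMAx⊆IMAx

⊢IM⇒⊢iM : ∀ {Γ φ} → Γ ˢᵇ ⊢IM φ ᵇ → Γ ⊢iM φ
⊢IM⇒⊢iM {Γ} {φ} d = subst (Γ ⊢iM_) (unᵇ-ᵇ φ) (unᵇ-Der unᵇ-ˢᵇ d)
  where
  unᵇ-ˢᵇ : ∀ {χ} → (Γ ˢᵇ) χ → Γ ⊢iM unᵇ χ
  unᵇ-ˢᵇ (ψ , x , refl) = subst (Γ ⊢iM_) (sym (unᵇ-ᵇ ψ)) (el x)

theorem4p9 : (Γ : Set▽) (φ : Fm▽) →
    ((Γ ⊢iM φ) ⇔ ((Γ ˢᵇ) ⊢WM (φ ᵇ))) × (((Γ ˢᵇ) ⊢WM (φ ᵇ)) ⇔ ((Γ ˢᵇ) ⊢IM (φ ᵇ)))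
theorem4p9 Γ φ = mk⇔ ⊢iM⇒⊢WM (⊢IM⇒⊢iM ∘ ⊢WM⇒⊢IM) , mk⇔ ⊢WM⇒⊢IM (⊢iM⇒⊢WM ∘ ⊢IM⇒⊢iM)
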